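{- Let $G$ be a finite simple graph of order $n \ge 4$ such that both $G$ and its complement $\overline{G}$ are connected. Then $Z(G) \le n-3$.
   Context: For a finite simple graph $G$, color a set $S\subseteq V(G)$ black and all other vertices white. The color-change rule: if a black vertex $u$ has exactly one white neighbor $w$, then $w$ is turned black. $S$ is a zero forcing set of $G$ if repeated application of the color-change rule eventually turns all vertices black. The zero forcing number $Z(G)$ is the minimum cardinality of a zero forcing set of $G$. The complement $\overline{G}$ has vertex set $V(G)$, with $uv$ an edge iff $uv$ is not an edge of $G$. -}

module Defs where

open import Data.Nat using (ℕ; _≤_)
open import Data.Fin using (Fin)
open import Data.Bool using (Bool; true; false; not)
open import Data.Fin.Subset using (Subset; _∈_; _∉_; ∣_∣)
open import Data.Product using (Σ; _×_; ∃)
open import Relation.Binary.PropositionalEquality using (_≡_; _≢_)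
open import Relation.Binary.Construct.Closure.ReflexiveTransitive using (Star)
open import Relation.Nullary using (¬_)
open import Relation.Nullary.Decidable using (⌊_⌋)
open import Data.Fin using (_≟_)

record Graph (n : ℕ) : Set where
  field
    adj     : Fin n → Fin n → Bool
    sym     : ∀ u v → adj u v ≡ adj v u
    irrefl  : ∀ v → adj v v ≡ false

open Graph public

Adj : ∀ {n} → Graph n → Fin n → Fin n → Set
Adj G u v = adj G u v ≡ true

complement : ∀ {n} → Graph n → Graph n
complement {n} G = record { adj = a ; sym = s ; irrefl = i }
  where
  open import Data.Bool using (_∧_)
  open import Relation.Binary.PropositionalEquality using (refl; cong₂)
  a : Fin n → Fin n → Bool
  a u v = not ⌊ u ≟ v ⌋ ∧ not (adj G u v)
  s : ∀ u v → a u v ≡ a v u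
  s u v with u ≟ v | v ≟ u
  ... | Relation.Nullary.yes _ | Relation.Nullary.yes _ = refl
  ... | Relation.Nullary.no _  | Relation.Nullary.no _  = Relation.Binary.PropositionalEquality.cong not (Graph.sym G u v)
  ... | Relation.Nullary.yes p | Relation.Nullary.no q  = Data.Empty.⊥-elim (q (Relation.Binary.PropositionalEquality.sym p))
    where import Data.Empty
  ... | Relation.Nullary.no q  | Relation.Nullary.yes p = Data.Empty.⊥-elim (q (Relation.Binary.PropositionalEquality.sym p))
    where import Data.Empty
  i : ∀ v → a v v ≡ false
  i v with v ≟ v
  ... | Relation.Nullary.yes _ = refl
  ... | Relation.Nullary.no q  = Data.Empty.⊥-elim (q refl)
    where import Data.Empty

Connected : ∀ {n} → Graph n → Set
Connected G = ∀ u v → Star (Adj G) u v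

-- Vertices that eventually become black starting from black set S,
-- under the color-change rule: a black vertex u with exactly one white
-- neighbour w forces w.  (Inductive closure = result of repeatedly
-- applying the rule; the final coloring is independent of order.)
data Black {n : ℕ} (G : Graph n) (S : Subset n) : Fin n → Set where
  initial : ∀ {v} → v ∈ S → Black G S v
  force   : ∀ {u w} → Black G S u → Adj G u w →
            (∀ x → Adj G u x → x ≢ w → Black G S x) →
            Black G S w

ZeroForcingSet : ∀ {n} → Graph n → Subset n → Set
ZeroForcingSet G S = ∀ v → Black G S v

ZeroForcingNumber≤ : ∀ {n} → Graph n → ℕ → Set
ZeroForcingNumber≤ {n} G k = Σ (Subset n) λ S → ZeroForcingSet G S × ∣ S ∣ ≤ k

-- If some vertex e is adjacent to c but not to d, and c, d have a common
-- non-neighbour a, then V ∖ {b, c, d} is zero forcing for any neighbour b of a: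
-- a forces b, then e forces c, then any neighbour of d forces d.
-- Otherwise any two vertices with a common non-neighbour are twins (same
-- neighbours apart from each other).  Then a connected complement has
-- diameter at most 2, so the two ends of every edge of G are twins, and
-- walking along a G-path from u to a complement-neighbour v keeps the current
-- vertex non-adjacent to v, which is absurd at the end of the path.
module Submission where

open import Defs hiding (sym)
open import Data.Nat using (ℕ; _≤_; _∸_; _+_; suc; s≤s)
open import Data.Nat.Properties using (m+n≤o⇒m≤o∸n; +-comm; module ≤-Reasoning)
open import Data.Fin using (Fin; _≟_; zero) renaming (suc to fsuc)
open import Data.Fin.Properties using (any?)
open import Data.Fin.Subset using (Subset; _∈_; ∣_∣; ⊤; _-_)
open import Data.Fin.Subset.Properties using (∈⊤; x∈p∧x≢y⇒x∈p-y; x∈p⇒∣p-x∣<∣p∣; ∣⊤∣≡n)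
open import Data.Bool using (true; false)
import Data.Bool as Bool
open import Data.Product using (∃; _×_; _,_; proj₁; proj₂)
open import Data.Empty using (⊥-elim)
open import Relation.Binary.PropositionalEquality using (_≡_; _≢_; refl; sym; trans; ≢-sym)
open import Relation.Binary.Construct.Closure.ReflexiveTransitive using (Star; ε; _◅_)
open import Relation.Nullary using (¬_; Dec; yes; no)
open import Relation.Nullary.Decidable using (_×-dec_; ¬?; map′)

∣⊤-x-y-z∣≤n∸3 : ∀ {n} {x y z : Fin n} → x ≢ y → x ≢ z → y ≢ z →
                ∣ ⊤ - x - y - z ∣ ≤ n ∸ 3
∣⊤-x-y-z∣≤n∸3 {n} {x} {y} {z} x≢y x≢z y≢z =
  m+n≤o⇒m≤o∸n ∣ ⊤ - x - y - z ∣ (begin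
    ∣ ⊤ - x - y - z ∣ + 3   ≡⟨ +-comm ∣ ⊤ - x - y - z ∣ 3 ⟩
    3 + ∣ ⊤ - x - y - z ∣   ≤⟨ s≤s (s≤s (x∈p⇒∣p-x∣<∣p∣ z∈⊤-x-y)) ⟩
    2 + ∣ ⊤ - x - y ∣       ≤⟨ s≤s (x∈p⇒∣p-x∣<∣p∣ y∈⊤-x) ⟩
    1 + ∣ ⊤ - x ∣           ≤⟨ x∈p⇒∣p-x∣<∣p∣ {p = ⊤ {n}} (∈⊤ {x = x}) ⟩
    ∣ ⊤ {n} ∣               ≡⟨ ∣⊤∣≡n n ⟩
    n                       ∎)
  where
  open ≤-Reasoning
  y∈⊤-x = x∈p∧x≢y⇒x∈p-y ∈⊤ (≢-sym x≢y)
  z∈⊤-x-y = x∈p∧x≢y⇒x∈p-y (x∈p∧x≢y⇒x∈p-y ∈⊤ (≢-sym x≢z)) (≢-sym y≢z)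

module _ {n : ℕ} (G : Graph n) where

  _≁_ : Fin n → Fin n → Set
  u ≁ v = u ≢ v × adj G u v ≡ false

  adj⇒≢ : ∀ {u v} → Adj G u v → u ≢ v
  adj⇒≢ {u} u~v refl with () ← trans (sym u~v) (irrefl G u)

  adj⇒¬≁ : ∀ {u v} → Adj G u v → ¬ (u ≁ v)
  adj⇒¬≁ u~v (_ , u≁v) with () ← trans (sym u~v) u≁v

  adj-≁⇒≢ : ∀ {u v w} → Adj G u v → u ≁ w → v ≢ w
  adj-≁⇒≢ u~v u≁w refl = adj⇒¬≁ u~v u≁w

  ≁-sym : ∀ {u v} → u ≁ v → v ≁ u
  ≁-sym {u} {v} (u≢v , u≁v) = ≢-sym u≢v , trans (Graph.sym G v u) u≁v

  complement-adj⇒≁ : ∀ {u v} → Adj (complement G) u v → u ≁ v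
  complement-adj⇒≁ {u} {v} h with u ≟ v | adj G u v
  complement-adj⇒≁ ()  | yes _ | _
  complement-adj⇒≁ ()  | no _  | true
  complement-adj⇒≁ _   | no u≢v | false = u≢v , refl

  ∃-neighbour : Connected G → ∀ {x y} → x ≢ y → ∃ (Adj G x)
  ∃-neighbour connected {x} {y} x≢y with connected x y
  ... | ε = ⊥-elim (x≢y refl)
  ... | x~w ◅ _ = _ , x~w

  record ForcingConfiguration (c d a e : Fin n) : Set where
    field
      a≁c : a ≁ c
      a≁d : a ≁ d
      e~c : Adj G e c
      e≁d : e ≁ d

  forcingConfiguration? : Dec (∃ λ c → ∃ λ d → ∃ λ a → ∃ λ e → ForcingConfiguration c d a e)
  forcingConfiguration? = any? λ c → any? λ d → any? λ a → any? λ e →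
    map′
      (λ (a≁c , a≁d , e~c , e≁d) → record { a≁c = a≁c ; a≁d = a≁d ; e~c = e~c ; e≁d = e≁d })
      (λ cfg → let open ForcingConfiguration cfg in a≁c , a≁d , e~c , e≁d)
      (≁? a c ×-dec ≁? a d ×-dec adj G e c Bool.≟ true ×-dec ≁? e d)
    where
    ≁? : ∀ u v → Dec (u ≁ v)
    ≁? u v = ¬? (u ≟ v) ×-dec adj G u v Bool.≟ false

  black-if-≢ : ∀ {S w x} → Black G S w → (x ≢ w → Black G S x) → Black G S x
  black-if-≢ {w = w} {x} black-w black-≢w with x ≟ w
  ... | yes refl = black-w
  ... | no x≢w = black-≢w x≢w

  module _ {c d a e b f : Fin n} (cfg : ForcingConfiguration c d a e)
           (a~b : Adj G a b) (d~f : Adj G d f) where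
    open ForcingConfiguration cfg

    b≢c : b ≢ c
    b≢c = adj-≁⇒≢ a~b a≁c
    b≢d : b ≢ d
    b≢d = adj-≁⇒≢ a~b a≁d
    c≢d : c ≢ d
    c≢d = adj-≁⇒≢ e~c e≁d

    S : Subset n
    S = ⊤ - b - c - d

    black-initial : ∀ {x} → x ≢ b → x ≢ c → x ≢ d → Black G S x
    black-initial x≢b x≢c x≢d =
      initial (x∈p∧x≢y⇒x∈p-y (x∈p∧x≢y⇒x∈p-y (x∈p∧x≢y⇒x∈p-y ∈⊤ x≢b) x≢c) x≢d)

    black-b : Black G S b
    black-b = force (black-initial (adj⇒≢ a~b) (proj₁ a≁c) (proj₁ a≁d)) a~b
      λ x a~x x≢b → black-initial x≢b (adj-≁⇒≢ a~x a≁c) (adj-≁⇒≢ a~x a≁d)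

    black-≢c,d : ∀ {x} → x ≢ c → x ≢ d → Black G S x
    black-≢c,d x≢c x≢d = black-if-≢ black-b λ x≢b → black-initial x≢b x≢c x≢d

    black-c : Black G S c
    black-c = force (black-≢c,d (adj⇒≢ e~c) (proj₁ e≁d)) e~c
      λ x e~x x≢c → black-≢c,d x≢c (adj-≁⇒≢ e~x e≁d)

    black-≢d : ∀ {x} → x ≢ d → Black G S x
    black-≢d x≢d = black-if-≢ black-c λ x≢c → black-≢c,d x≢c x≢d

    forcingConfiguration⇒Z≤n∸3 : ZeroForcingNumber≤ G (n ∸ 3)
    forcingConfiguration⇒Z≤n∸3 = S , zeroForcing , ∣⊤-x-y-z∣≤n∸3 b≢c b≢d c≢d
      where
      f~d : Adj G f d
      f~d = trans (Graph.sym G f d) d~f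
      black-d : Black G S d
      black-d = force (black-≢d (≢-sym (adj⇒≢ d~f))) f~d λ x _ x≢d → black-≢d x≢d
      zeroForcing : ZeroForcingSet G S
      zeroForcing x = black-if-≢ black-d black-≢d

  module NoForcingConfiguration
           (noConfiguration : ∀ {c d a e} → ¬ ForcingConfiguration c d a e) where

    twin-≁ : ∀ {a c d t} → a ≁ c → a ≁ d → t ≢ c → t ≁ d → t ≁ c
    twin-≁ {c = c} {t = t} a≁c a≁d t≢c t≁d with adj G t c in t-c
    ... | false = t≢c , refl
    ... | true = ⊥-elim (noConfiguration record
                   { a≁c = a≁c ; a≁d = a≁d ; e~c = t-c ; e≁d = t≁d })

    data ComplementDistance≤2 (x y : Fin n) : Set where
      same     : x ≡ y → ComplementDistance≤2 x y
      adjacent : x ≁ y → ComplementDistance≤2 x y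
      common   : ∀ m → m ≁ x → m ≁ y → ComplementDistance≤2 x y

    complement-walk⇒distance≤2 : ∀ {x y} → Star (Adj (complement G)) x y → ComplementDistance≤2 x y
    complement-walk⇒distance≤2 ε = same refl
    complement-walk⇒distance≤2 {x} {y} (h ◅ walk)
      with complement-adj⇒≁ h | complement-walk⇒distance≤2 walk
    ... | x≁x₁ | same refl = adjacent x≁x₁
    ... | x≁x₁ | adjacent x₁≁y = common _ (≁-sym x≁x₁) x₁≁y
    ... | x≁x₁ | common m m≁x₁ m≁y with x ≟ m | x ≟ y
    ...   | yes refl | _ = adjacent m≁y
    ...   | no _ | yes x≡y = same x≡y
    ...   | no x≢m | no x≢y =
      adjacent (≁-sym (twin-≁ (≁-sym x≁x₁) (≁-sym m≁x₁) (≢-sym x≢y) (≁-sym m≁y)))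

    ¬walk-from-≁ : Connected (complement G) → ∀ {w v} → w ≁ v → ¬ Star (Adj G) w v
    ¬walk-from-≁ _ (w≢v , _) ε = w≢v refl
    ¬walk-from-≁ connected {w} {v} w≁v (_◅_ {j = w′} w~w′ walk)
      with complement-walk⇒distance≤2 (connected w w′)
    ... | same refl = adj⇒≢ w~w′ refl
    ... | adjacent w≁w′ = adj⇒¬≁ w~w′ w≁w′
    ... | common m m≁w m≁w′ =
      ¬walk-from-≁ connected
        (≁-sym (twin-≁ m≁w′ m≁w (≢-sym (adj-≁⇒≢ w~w′ w≁v)) (≁-sym w≁v))) walk

theorem2p5 : (n : ℕ) → 4 ≤ n → (G : Graph n) →
    Connected G → Connected (complement G) →
    ZeroForcingNumber≤ G (n ∸ 3)
theorem2p5 (suc (suc _)) (s≤s (s≤s _)) G connected co-connected with forcingConfiguration? G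
... | yes (c , d , a , e , cfg) =
  forcingConfiguration⇒Z≤n∸3 G cfg (proj₂ (∃-neighbour G connected (proj₁ a≁c)))
                                    (proj₂ (∃-neighbour G connected (≢-sym (proj₁ a≁d))))
  where open ForcingConfiguration cfg
... | no noConfiguration
  with ∃-neighbour (complement G) co-connected {zero} {fsuc zero} (λ ())
...   | v , 0~v = ⊥-elim (¬walk-from-≁ co-connected (complement-adj⇒≁ G 0~v) (connected zero v))
  where open NoForcingConfiguration G (λ cfg → noConfiguration (_ , _ , _ , _ , cfg))
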